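{- For every $*$-nnf formula $A$, each of the sequents $$A\Rightarrow1,\qquad 0\Rightarrow A,\qquad \Rightarrow A\vee\neg A,\qquad A\Rightarrow A*A$$ has a tree-like $G$-proof of size $|A|^{O(1)}$.
   Context: $\mathcal{L}_u$-formulas are built from atoms and constants $0,1$ by $\wedge,\vee,*,\to$; $\neg A:=A\to0$. A $*$-nnf formula is generated by $F::=p\mid\neg p\mid F_1\wedge F_2\mid F_1\vee F_2\mid F_1*F_2$ ($p$ an atom). $\mathbf{FL_e}$ is the single-conclusion sequent calculus (sequents $\Gamma\Rightarrow\Delta$, $\Gamma,\Delta$ finite multisets, $|\Delta|\le1$) with axioms $A\Rightarrow A$, $\Rightarrow1$, $0\Rightarrow$ and rules: from $\Gamma\Rightarrow\Delta$ infer $\Gamma,1\Rightarrow\Delta$; from $\Gamma\Rightarrow$ infer $\Gamma\Rightarrow0$; from $\Gamma,A_i\Rightarrow\Delta$ infer $\Gamma,A_0\wedge A_1\Rightarrow\Delta$; from $\Gamma\Rightarrow A$ and $\Gamma\Rightarrow B$ infer $\Gamma\Rightarrow A\wedge B$; from $\Gamma,A\Rightarrow\Delta$ and $\Gamma,B\Rightarrow\Delta$ infer $\Gamma,A\vee B\Rightarrow\Delta$; from $\Gamma\Rightarrow A_i$ infer $\Gamma\Rightarrow A_0\vee A_1$; from $\Gamma,A,B\Rightarrow\Delta$ infer $\Gamma,A*B\Rightarrow\Delta$; from $\Gamma\Rightarrow A$ and $\Sigma\Rightarrow B$ infer $\Gamma,\Sigma\Rightarrow A*B$; from $\Gamma\Rightarrow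 A$ and $\Sigma,B\Rightarrow\Lambda$ infer $\Gamma,\Sigma,A\to B\Rightarrow\Lambda$; from $\Gamma,A\Rightarrow B$ infer $\Gamma\Rightarrow A\to B$; cut: from $\Gamma\Rightarrow A$ and $\Sigma,A\Rightarrow\Lambda$ infer $\Gamma,\Sigma\Rightarrow\Lambda$. $G$ is $\mathbf{FL_e}$ (with cut) plus the additional initial sequents, for every atom $p$: $\Rightarrow p\vee\neg p$, $p\Rightarrow1$, $\neg p\Rightarrow1$, $0\Rightarrow p$, $0\Rightarrow\neg p$, and also $0\Rightarrow0*0$; these initial sequents are only available for atoms $p$ (substitution instances are not allowed). A proof is tree-like if every sequent occurrence is used at most once as a premise. Size = number of symbols. -}

module Defs where

open import Data.Nat using (ℕ; suc; _+_)
open import Data.List using (List; []; _∷_; _++_; [_])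
open import Data.Maybe using (Maybe; just; nothing)
open import Data.List.Relation.Binary.Permutation.Propositional using (_↭_)

infixr 6 _∧_ _∨_ _⊛_
infixr 5 _⇒_
data Fm : Set where
  atom : ℕ → Fm
  𝟘 𝟙 : Fm
  _∧_ _∨_ _⊛_ _⇒_ : Fm → Fm → Fm

¬ : Fm → Fm
¬ A = A ⇒ 𝟘

∣_∣ : Fm → ℕ
∣ atom _ ∣ = 1
∣ 𝟘 ∣ = 1
∣ 𝟙 ∣ = 1
∣ A ∧ B ∣ = suc (∣ A ∣ + ∣ B ∣)
∣ A ∨ B ∣ = suc (∣ A ∣ + ∣ B ∣)
∣ A ⊛ B ∣ = suc (∣ A ∣ + ∣ B ∣)
∣ A ⇒ B ∣ = suc (∣ A ∣ + ∣ B ∣)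

data StarNNF : Fm → Set where
  pos  : ∀ p → StarNNF (atom p)
  neg  : ∀ p → StarNNF (¬ (atom p))
  conj : ∀ {A B} → StarNNF A → StarNNF B → StarNNF (A ∧ B)
  disj : ∀ {A B} → StarNNF A → StarNNF B → StarNNF (A ∨ B)
  fus  : ∀ {A B} → StarNNF A → StarNNF B → StarNNF (A ⊛ B)

-- Antecedents are multisets: lists taken up to permutation (↭) in every
-- rule conclusion.  Succedent: at most one formula (Maybe Fm).
Ctx = List Fm
Succ = Maybe Fm

-- Tree-like G-proofs (FL_e with cut plus the atomic initial sequents)
data Proof : Ctx → Succ → Set where
  ax   : ∀ {Γ} A → Γ ↭ [ A ] → Proof Γ (just A)
  𝟙R   : ∀ {Γ} → Γ ↭ [] → Proof Γ (just 𝟙)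
  ax0L : ∀ {Γ} → Γ ↭ [ 𝟘 ] → Proof Γ nothing
  em   : ∀ {Γ} p → Γ ↭ [] → Proof Γ (just (atom p ∨ ¬ (atom p)))
  axp1 : ∀ {Γ} p → Γ ↭ [ atom p ] → Proof Γ (just 𝟙)
  axnp1 : ∀ {Γ} p → Γ ↭ [ ¬ (atom p) ] → Proof Γ (just 𝟙)
  ax0p : ∀ {Γ} p → Γ ↭ [ 𝟘 ] → Proof Γ (just (atom p))
  ax0np : ∀ {Γ} p → Γ ↭ [ 𝟘 ] → Proof Γ (just (¬ (atom p)))
  ax000 : ∀ {Γ} → Γ ↭ [ 𝟘 ] → Proof Γ (just (𝟘 ⊛ 𝟘))
  𝟙L   : ∀ {Γ Γ' Δ} → Proof Γ Δ → Γ' ↭ 𝟙 ∷ Γ → Proof Γ' Δ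
  𝟘R   : ∀ {Γ} → Proof Γ nothing → Proof Γ (just 𝟘)
  ∧L₀  : ∀ {Γ Γ' A B Δ} → Proof (A ∷ Γ) Δ → Γ' ↭ (A ∧ B) ∷ Γ → Proof Γ' Δ
  ∧L₁  : ∀ {Γ Γ' A B Δ} → Proof (B ∷ Γ) Δ → Γ' ↭ (A ∧ B) ∷ Γ → Proof Γ' Δ
  ∧R   : ∀ {Γ A B} → Proof Γ (just A) → Proof Γ (just B) → Proof Γ (just (A ∧ B))
  ∨L   : ∀ {Γ Γ' A B Δ} → Proof (A ∷ Γ) Δ → Proof (B ∷ Γ) Δ → Γ' ↭ (A ∨ B) ∷ Γ → Proof Γ' Δ
  ∨R₀  : ∀ {Γ A B} → Proof Γ (just A) → Proof Γ (just (A ∨ B))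
  ∨R₁  : ∀ {Γ A B} → Proof Γ (just B) → Proof Γ (just (A ∨ B))
  ⊛L   : ∀ {Γ Γ' A B Δ} → Proof (A ∷ B ∷ Γ) Δ → Γ' ↭ (A ⊛ B) ∷ Γ → Proof Γ' Δ
  ⊛R   : ∀ {Γ Σ Γ' A B} → Proof Γ (just A) → Proof Σ (just B) → Γ' ↭ Γ ++ Σ → Proof Γ' (just (A ⊛ B))
  ⇒L   : ∀ {Γ Σ Γ' A B Λ} → Proof Γ (just A) → Proof (B ∷ Σ) Λ → Γ' ↭ (A ⇒ B) ∷ Γ ++ Σ → Proof Γ' Λ
  ⇒R   : ∀ {Γ A B} → Proof (A ∷ Γ) (just B) → Proof Γ (just (A ⇒ B))
  cut  : ∀ {Γ Σ Γ' A Λ} → Proof Γ (just A) → Proof (A ∷ Σ) Λ → Γ' ↭ Γ ++ Σ → Proof Γ' Λ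

ctxSize : Ctx → ℕ
ctxSize [] = 0
ctxSize (A ∷ Γ) = ∣ A ∣ + ctxSize Γ

succSize : Succ → ℕ
succSize nothing = 0
succSize (just A) = ∣ A ∣

-- number of symbols of a sequent (the "⇒" counted as one symbol)
seqSize : Ctx → Succ → ℕ
seqSize Γ Δ = suc (ctxSize Γ + succSize Δ)

size : ∀ {Γ Δ} → Proof Γ Δ → ℕ
size {Γ} {Δ} π = seqSize Γ Δ + sub π
  where
  sub : ∀ {Γ Δ} → Proof Γ Δ → ℕ
  sub (ax _ _) = 0
  sub (𝟙R _) = 0
  sub (ax0L _) = 0
  sub (em _ _) = 0
  sub (axp1 _ _) = 0
  sub (axnp1 _ _) = 0
  sub (ax0p _ _) = 0
  sub (ax0np _ _) = 0
  sub (ax000 _) = 0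
  sub (𝟙L π _) = size π
  sub (𝟘R π) = size π
  sub (∧L₀ π _) = size π
  sub (∧L₁ π _) = size π
  sub (∧R π ρ) = size π + size ρ
  sub (∨L π ρ _) = size π + size ρ
  sub (∨R₀ π) = size π
  sub (∨R₁ π) = size π
  sub (⊛L π _) = size π
  sub (⊛R π ρ _) = size π + size ρ
  sub (⇒L π ρ _) = size π + size ρ
  sub (⇒R π) = size π
  sub (cut π ρ _) = size π + size ρ

ProvableWithin : Ctx → Succ → ℕ → Set
ProvableWithin Γ Δ b = Σ' (Proof Γ Δ) (λ π → size π Data.Nat.≤ b)
  where open import Data.Product using () renaming (Σ to Σ')

-- All four sequents are built by one simultaneous induction on the *-nnf formula A, every
-- step adding O(|A|) symbols of new sequents on top of the proofs for the immediate
-- subformulas.  Since ¬ A ⇒ 1 is not derivable, excluded middle is proved for the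
-- discardable negation ∼ A = ¬ A ∧ 1 and converted to A ∨ ¬ A only at the very end.
-- Excluded middle and contraction for B ∧ C and B ⊛ C go by cases on B ∨ ∼ B and
-- C ∨ ∼ C; in the refuted cases of contraction one proves 0 and uses 0 ⇒ A ⊛ A.
-- These cases also call A ⇒ 1 and 0 ⇒ A on subformulas, so the sizes are O(|A|²) for
-- A ⇒ 1 and 0 ⇒ A and O(|A|³) for the other two sequents.
module Submission where

open import Defs
open import Data.Nat using (ℕ; suc; _+_; _*_; _^_; _≤_; _≤ᵇ_; s≤s; z≤n; NonZero)
open import Data.List using ([]; [_]; _∷_)
open import Data.Maybe using (just)
open import Data.Product using (∃-syntax; _×_; _,_)
open import Data.Bool using (T)
open import Data.Nat.Properties
  using (+-identityʳ; *-identityʳ; m≤m+n; m≤m*n; m≤n*m; ≤-refl; ≤-trans; ≤-reflexive;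
         +-mono-≤; +-monoˡ-≤; +-monoʳ-≤; *-monoˡ-≤; *-monoʳ-≤; ≤ᵇ⇒≤; module ≤-Reasoning)
open import Data.Nat.Tactic.RingSolver using (solve)
open import Data.List.Relation.Binary.Permutation.Propositional using (_↭_; ↭-refl; ↭-trans; prep; swap)
open import Relation.Binary.PropositionalEquality using (_≡_; sym; cong; cong₂; subst)

private variable
  Γ Γ' : Ctx
  Δ : Succ
  A B C D : Fm
  k n x y u v z : ℕ

-- Equal to size (see ‖‖≡size), but defined by matching on the proof, so that the size of a
-- proof variable stays an atom that with-abstraction can turn into a number variable.
‖_‖ : Proof Γ Δ → ℕ
‖_‖ {Γ} {Δ} (𝟙L π _)    = seqSize Γ Δ + ‖ π ‖
‖_‖ {Γ} {Δ} (𝟘R π)      = seqSize Γ Δ + ‖ π ‖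
‖_‖ {Γ} {Δ} (∧L₀ π _)   = seqSize Γ Δ + ‖ π ‖
‖_‖ {Γ} {Δ} (∧L₁ π _)   = seqSize Γ Δ + ‖ π ‖
‖_‖ {Γ} {Δ} (∧R π ρ)    = seqSize Γ Δ + (‖ π ‖ + ‖ ρ ‖)
‖_‖ {Γ} {Δ} (∨L π ρ _)  = seqSize Γ Δ + (‖ π ‖ + ‖ ρ ‖)
‖_‖ {Γ} {Δ} (∨R₀ π)     = seqSize Γ Δ + ‖ π ‖
‖_‖ {Γ} {Δ} (∨R₁ π)     = seqSize Γ Δ + ‖ π ‖
‖_‖ {Γ} {Δ} (⊛L π _)    = seqSize Γ Δ + ‖ π ‖
‖_‖ {Γ} {Δ} (⊛R π ρ _)  = seqSize Γ Δ + (‖ π ‖ + ‖ ρ ‖)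
‖_‖ {Γ} {Δ} (⇒L π ρ _)  = seqSize Γ Δ + (‖ π ‖ + ‖ ρ ‖)
‖_‖ {Γ} {Δ} (⇒R π)      = seqSize Γ Δ + ‖ π ‖
‖_‖ {Γ} {Δ} (cut π ρ _) = seqSize Γ Δ + (‖ π ‖ + ‖ ρ ‖)
‖_‖ {Γ} {Δ} _           = seqSize Γ Δ

‖‖≡size : (π : Proof Γ Δ) → ‖ π ‖ ≡ size π
‖‖≡size (ax _ _)               = sym (+-identityʳ _)
‖‖≡size (𝟙R _)                 = sym (+-identityʳ _)
‖‖≡size (ax0L _)               = sym (+-identityʳ _)
‖‖≡size (em _ _)               = sym (+-identityʳ _)
‖‖≡size (axp1 _ _)             = sym (+-identityʳ _)
‖‖≡size (axnp1 _ _)            = sym (+-identityʳ _)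
‖‖≡size (ax0p _ _)             = sym (+-identityʳ _)
‖‖≡size (ax0np _ _)            = sym (+-identityʳ _)
‖‖≡size (ax000 _)              = sym (+-identityʳ _)
‖‖≡size {Γ} {Δ} (𝟙L π _)       = cong (seqSize Γ Δ +_) (‖‖≡size π)
‖‖≡size {Γ} {Δ} (𝟘R π)         = cong (seqSize Γ Δ +_) (‖‖≡size π)
‖‖≡size {Γ} {Δ} (∧L₀ π _)      = cong (seqSize Γ Δ +_) (‖‖≡size π)
‖‖≡size {Γ} {Δ} (∧L₁ π _)      = cong (seqSize Γ Δ +_) (‖‖≡size π)
‖‖≡size {Γ} {Δ} (∧R π ρ)       = cong (seqSize Γ Δ +_) (cong₂ _+_ (‖‖≡size π) (‖‖≡size ρ))
‖‖≡size {Γ} {Δ} (∨L π ρ _)     = cong (seqSize Γ Δ +_) (cong₂ _+_ (‖‖≡size π) (‖‖≡size ρ))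
‖‖≡size {Γ} {Δ} (∨R₀ π)        = cong (seqSize Γ Δ +_) (‖‖≡size π)
‖‖≡size {Γ} {Δ} (∨R₁ π)        = cong (seqSize Γ Δ +_) (‖‖≡size π)
‖‖≡size {Γ} {Δ} (⊛L π _)       = cong (seqSize Γ Δ +_) (‖‖≡size π)
‖‖≡size {Γ} {Δ} (⊛R π ρ _)     = cong (seqSize Γ Δ +_) (cong₂ _+_ (‖‖≡size π) (‖‖≡size ρ))
‖‖≡size {Γ} {Δ} (⇒L π ρ _)     = cong (seqSize Γ Δ +_) (cong₂ _+_ (‖‖≡size π) (‖‖≡size ρ))
‖‖≡size {Γ} {Δ} (⇒R π)         = cong (seqSize Γ Δ +_) (‖‖≡size π)
‖‖≡size {Γ} {Δ} (cut π ρ _)    = cong (seqSize Γ Δ +_) (cong₂ _+_ (‖‖≡size π) (‖‖≡size ρ))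

∼ : Fm → Fm
∼ A = ¬ A ∧ 𝟙

rotate : A ∷ B ∷ C ∷ [] ↭ C ∷ A ∷ B ∷ []
rotate {A} {B} {C} = ↭-trans (prep A (swap B C ↭-refl)) (swap A C ↭-refl)

weaken : Proof [ D ] (just 𝟙) → Proof Γ Δ → Γ' ↭ D ∷ Γ → Proof Γ' Δ
weaken u π p = cut u (𝟙L π ↭-refl) p

¬-elim : ∀ A → Γ ↭ ¬ A ∷ [ A ] → Proof Γ (just 𝟘)
¬-elim A p = ⇒L (ax A ↭-refl) (ax 𝟘 ↭-refl) p

∼-elim : ∀ A → Γ ↭ ∼ A ∷ [ A ] → Proof Γ (just 𝟘)
∼-elim A p = ∧L₀ (¬-elim A ↭-refl) p

discard-∼ : ∀ A → Proof [ ∼ A ] (just 𝟙)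
discard-∼ A = ∧L₁ (ax 𝟙 ↭-refl) ↭-refl

pair : Proof [ B ] (just 𝟙) → Proof [ C ] (just 𝟙) → Proof (C ∷ [ B ]) (just (B ∧ C))
pair {B} {C} uB uC = ∧R (weaken uC (ax B ↭-refl) ↭-refl) (weaken uB (ax C ↭-refl) (swap C B ↭-refl))

by-cases : Proof [] (just (B ∨ ∼ B)) → Proof [] (just (C ∨ ∼ C))
         → Proof (C ∷ B ∷ Γ) Δ → Proof (∼ C ∷ B ∷ Γ) Δ → Proof (∼ B ∷ Γ) Δ → Proof Γ Δ
by-cases eB eC both onlyB notB = cut eB (∨L (cut eC (∨L both onlyB ↭-refl) ↭-refl) notB ↭-refl) ↭-refl

discard-∧ : Proof [ B ] (just 𝟙) → Proof [ B ∧ C ] (just 𝟙)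
discard-∧ uB = ∧L₀ uB ↭-refl

discard-∨ : Proof [ B ] (just 𝟙) → Proof [ C ] (just 𝟙) → Proof [ B ∨ C ] (just 𝟙)
discard-∨ uB uC = ∨L uB uC ↭-refl

discard-⊛ : Proof [ B ] (just 𝟙) → Proof [ C ] (just 𝟙) → Proof [ B ⊛ C ] (just 𝟙)
discard-⊛ uB uC = ⊛L (weaken uB uC ↭-refl) ↭-refl

explode-∧ : Proof [ 𝟘 ] (just B) → Proof [ 𝟘 ] (just C) → Proof [ 𝟘 ] (just (B ∧ C))
explode-∧ zB zC = ∧R zB zC

explode-∨ : Proof [ 𝟘 ] (just B) → Proof [ 𝟘 ] (just (B ∨ C))
explode-∨ zB = ∨R₀ zB

explode-⊛ : Proof [ 𝟘 ] (just B) → Proof [ 𝟘 ] (just C) → Proof [ 𝟘 ] (just (B ⊛ C))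
explode-⊛ zB zC = cut (ax000 ↭-refl) (⊛L (⊛R zB zC ↭-refl) ↭-refl) ↭-refl

decide-∨ : Proof [] (just (B ∨ ∼ B)) → Proof [] (just (C ∨ ∼ C))
         → Proof [] (just ((B ∨ C) ∨ ∼ (B ∨ C)))
decide-∨ {B} {C} eB eC =
  cut eB (∨L (∨R₀ (∨R₀ (ax B ↭-refl))) (cut eC (∨L onlyC neither ↭-refl) ↭-refl) ↭-refl) ↭-refl
  where
  onlyC : Proof (C ∷ [ ∼ B ]) (just ((B ∨ C) ∨ ∼ (B ∨ C)))
  onlyC = ∨R₀ (∨R₁ (weaken (discard-∼ B) (ax C ↭-refl) (swap C (∼ B) ↭-refl)))
  refute : Proof ((B ∨ C) ∷ ∼ C ∷ [ ∼ B ]) (just 𝟘)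
  refute = ∨L (weaken (discard-∼ C) (∼-elim B (swap B (∼ B) ↭-refl)) (swap B (∼ C) ↭-refl))
              (weaken (discard-∼ B) (∼-elim C (swap C (∼ C) ↭-refl)) rotate) ↭-refl
  neither : Proof (∼ C ∷ [ ∼ B ]) (just ((B ∨ C) ∨ ∼ (B ∨ C)))
  neither = ∨R₁ (∧R (⇒R refute) (weaken (discard-∼ C) (discard-∼ B) ↭-refl))

decide-∧ : Proof [] (just (B ∨ ∼ B)) → Proof [] (just (C ∨ ∼ C))
         → Proof [ B ] (just 𝟙) → Proof [ C ] (just 𝟙) → Proof [] (just ((B ∧ C) ∨ ∼ (B ∧ C)))
decide-∧ {B} {C} eB eC uB uC =
  by-cases eB eC (∨R₀ (pair uB uC)) (∨R₁ (weaken uB notC (swap (∼ C) B ↭-refl))) (∨R₁ notB)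
  where
  notB : Proof [ ∼ B ] (just (∼ (B ∧ C)))
  notB = ∧R (⇒R (∧L₀ (∼-elim B (swap B (∼ B) ↭-refl)) ↭-refl)) (discard-∼ B)
  notC : Proof [ ∼ C ] (just (∼ (B ∧ C)))
  notC = ∧R (⇒R (∧L₁ (∼-elim C (swap C (∼ C) ↭-refl)) ↭-refl)) (discard-∼ C)

decide-⊛ : Proof [] (just (B ∨ ∼ B)) → Proof [] (just (C ∨ ∼ C))
         → Proof [ B ] (just 𝟙) → Proof [ C ] (just 𝟙) → Proof [] (just ((B ⊛ C) ∨ ∼ (B ⊛ C)))
decide-⊛ {B} {C} eB eC uB uC =
  by-cases eB eC (∨R₀ (⊛R (ax B ↭-refl) (ax C ↭-refl) (swap C B ↭-refl)))
                 (∨R₁ (weaken uB notC (swap (∼ C) B ↭-refl)))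
                 (∨R₁ notB)
  where
  notB : Proof [ ∼ B ] (just (∼ (B ⊛ C)))
  notB = ∧R (⇒R (⊛L (weaken uC (∼-elim B (swap B (∼ B) ↭-refl)) (swap B C ↭-refl)) ↭-refl))
            (discard-∼ B)
  notC : Proof [ ∼ C ] (just (∼ (B ⊛ C)))
  notC = ∧R (⇒R (⊛L (weaken uB (∼-elim C (swap C (∼ C) ↭-refl)) ↭-refl) ↭-refl)) (discard-∼ C)

duplicate-∨ : Proof [ B ] (just (B ⊛ B)) → Proof [ C ] (just (C ⊛ C))
            → Proof [ B ∨ C ] (just ((B ∨ C) ⊛ (B ∨ C)))
duplicate-∨ {B} {C} dB dC =
  ∨L (cut dB (⊛L (⊛R (∨R₀ (ax B ↭-refl)) (∨R₀ (ax B ↭-refl)) ↭-refl) ↭-refl) ↭-refl)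
     (cut dC (⊛L (⊛R (∨R₁ (ax C ↭-refl)) (∨R₁ (ax C ↭-refl)) ↭-refl) ↭-refl) ↭-refl) ↭-refl

duplicate-⊛ : Proof [ B ] (just (B ⊛ B)) → Proof [ C ] (just (C ⊛ C))
            → Proof [ B ⊛ C ] (just ((B ⊛ C) ⊛ (B ⊛ C)))
duplicate-⊛ {B} {C} dB dC =
  ⊛L (cut dB (cut dC (⊛L (⊛L shuffle rotate) ↭-refl) (swap (B ⊛ B) C ↭-refl)) ↭-refl) ↭-refl
  where
  B⊢B⊛C : Proof (B ∷ [ C ]) (just (B ⊛ C))
  B⊢B⊛C = ⊛R (ax B ↭-refl) (ax C ↭-refl) ↭-refl
  shuffle : Proof (B ∷ B ∷ C ∷ [ C ]) (just ((B ⊛ C) ⊛ (B ⊛ C)))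
  shuffle = ⊛R B⊢B⊛C B⊢B⊛C (prep B (swap B C ↭-refl))

duplicate-∧ : Proof [] (just (B ∨ ∼ B)) → Proof [] (just (C ∨ ∼ C))
            → Proof [ B ] (just 𝟙) → Proof [ C ] (just 𝟙)
            → Proof [ 𝟘 ] (just ((B ∧ C) ⊛ (B ∧ C))) → Proof [ B ∧ C ] (just ((B ∧ C) ⊛ (B ∧ C)))
duplicate-∧ {B} {C} eB eC uB uC z =
  by-cases eB eC (⊛R (ax (B ∧ C) ↭-refl) (pair uB uC) rotate) onlyB notB
  where
  onlyB : Proof (∼ C ∷ B ∷ [ B ∧ C ]) (just ((B ∧ C) ⊛ (B ∧ C)))
  onlyB = ∧L₁ (cut (weaken uB (∼-elim C (swap C (∼ C) ↭-refl)) rotate) z ↭-refl) rotate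
  notB : Proof (∼ B ∷ [ B ∧ C ]) (just ((B ∧ C) ⊛ (B ∧ C)))
  notB = ∧L₀ (cut (∼-elim B (swap B (∼ B) ↭-refl)) z ↭-refl) (swap (∼ B) (B ∧ C) ↭-refl)

module _ (p : ℕ) where
  private
    P = atom p

  decide-atom : Proof [] (just (P ∨ ∼ P))
  decide-atom =
    cut (em p ↭-refl) (∨L (∨R₀ (ax P ↭-refl)) (∨R₁ (∧R (ax (¬ P) ↭-refl) (axnp1 p ↭-refl))) ↭-refl) ↭-refl

  decide-¬atom : Proof [] (just (¬ P ∨ ∼ (¬ P)))
  decide-¬atom =
    cut (em p ↭-refl) (∨L (∨R₁ (∧R (⇒R (¬-elim P ↭-refl)) (axp1 p ↭-refl)))
                          (∨R₀ (ax (¬ P) ↭-refl)) ↭-refl) ↭-refl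

  duplicate-atom : Proof [ 𝟘 ] (just (P ⊛ P)) → Proof [ P ] (just (P ⊛ P))
  duplicate-atom z =
    cut (em p ↭-refl) (∨L (⊛R (ax P ↭-refl) (ax P ↭-refl) ↭-refl)
                          (cut (¬-elim P ↭-refl) z ↭-refl) ↭-refl) ↭-refl

  duplicate-¬atom : Proof [ 𝟘 ] (just (¬ P ⊛ ¬ P)) → Proof [ ¬ P ] (just (¬ P ⊛ ¬ P))
  duplicate-¬atom z =
    cut (em p ↭-refl) (∨L (cut (¬-elim P (swap P (¬ P) ↭-refl)) z ↭-refl)
                          (⊛R (ax (¬ P) ↭-refl) (ax (¬ P) ↭-refl) ↭-refl) ↭-refl) ↭-refl

excluded-middle : Proof [] (just (A ∨ ∼ A)) → Proof [] (just (A ∨ ¬ A))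
excluded-middle {A} e = cut e (∨L (∨R₀ (ax A ↭-refl)) (∨R₁ (∧L₀ (ax (¬ A) ↭-refl) ↭-refl)) ↭-refl) ↭-refl

discard : StarNNF A → Proof [ A ] (just 𝟙)
discard (pos p)    = axp1 p ↭-refl
discard (neg p)    = axnp1 p ↭-refl
discard (conj s _) = discard-∧ (discard s)
discard (disj s t) = discard-∨ (discard s) (discard t)
discard (fus s t)  = discard-⊛ (discard s) (discard t)

explode : StarNNF A → Proof [ 𝟘 ] (just A)
explode (pos p)    = ax0p p ↭-refl
explode (neg p)    = ax0np p ↭-refl
explode (conj s t) = explode-∧ (explode s) (explode t)
explode (disj s _) = explode-∨ (explode s)
explode (fus s t)  = explode-⊛ (explode s) (explode t)

decide : StarNNF A → Proof [] (just (A ∨ ∼ A))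
decide (pos p)    = decide-atom p
decide (neg p)    = decide-¬atom p
decide (conj s t) = decide-∧ (decide s) (decide t) (discard s) (discard t)
decide (disj s t) = decide-∨ (decide s) (decide t)
decide (fus s t)  = decide-⊛ (decide s) (decide t) (discard s) (discard t)

duplicate : StarNNF A → Proof [ A ] (just (A ⊛ A))
duplicate (pos p)    = duplicate-atom p (explode (fus (pos p) (pos p)))
duplicate (neg p)    = duplicate-¬atom p (explode (fus (neg p) (neg p)))
duplicate (conj s t) =
  duplicate-∧ (decide s) (decide t) (discard s) (discard t) (explode (fus (conj s t) (conj s t)))
duplicate (disj s t) = duplicate-∨ (duplicate s) (duplicate t)
duplicate (fus s t)  = duplicate-⊛ (duplicate s) (duplicate t)

≤-by-slack : ∀ {m n} s → m + s ≡ n → m ≤ n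
≤-by-slack s eq = ≤-trans (m≤m+n _ s) (≤-reflexive eq)

square-growth₁ : ∀ l b c → x ≤ l * (b * b) → l * suc (b + c) + x ≤ l * (suc (b + c) * suc (b + c))
square-growth₁ {x = x} l b c hx = begin
  l * suc (b + c) + x             ≤⟨ +-monoʳ-≤ (l * suc (b + c)) hx ⟩
  l * suc (b + c) + l * (b * b)   ≤⟨ ≤-by-slack (l * (c * c + 2 * b * c + b + c)) (solve (l ∷ b ∷ c ∷ [])) ⟩
  l * (suc (b + c) * suc (b + c)) ∎
  where open ≤-Reasoning

square-growth₂ : ∀ l b c → x ≤ l * (b * b) → y ≤ l * (c * c)
               → l * suc (b + c) + (x + y) ≤ l * (suc (b + c) * suc (b + c))
square-growth₂ {x = x} {y = y} l b c hx hy = begin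
  l * suc (b + c) + (x + y)                     ≤⟨ +-monoʳ-≤ (l * suc (b + c)) (+-mono-≤ hx hy) ⟩
  l * suc (b + c) + (l * (b * b) + l * (c * c)) ≤⟨ ≤-by-slack (l * (2 * b * c + b + c)) (solve (l ∷ b ∷ c ∷ [])) ⟩
  l * (suc (b + c) * suc (b + c))               ∎
  where open ≤-Reasoning

cube-growth₂ : ∀ l b c → k ≤ l → x ≤ l * (b * (b * b)) → y ≤ l * (c * (c * c))
             → k * suc (b + c) + (x + y) ≤ l * (suc (b + c) * (suc (b + c) * suc (b + c)))
cube-growth₂ {k = k} {x = x} {y = y} l b c k≤l hx hy = begin
  k * suc (b + c) + (x + y)
    ≤⟨ +-mono-≤ (*-monoˡ-≤ (suc (b + c)) k≤l) (+-mono-≤ hx hy) ⟩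
  l * suc (b + c) + (l * (b * (b * b)) + l * (c * (c * c)))
    ≤⟨ ≤-by-slack (l * (3 * b * b * c + 3 * b * c * c + 3 * b * b + 3 * c * c + 6 * b * c + 2 * b + 2 * c))
                  (solve (l ∷ b ∷ c ∷ [])) ⟩
  l * (suc (b + c) * (suc (b + c) * suc (b + c)))
    ∎
  where open ≤-Reasoning

cube-growth₄ : ∀ l b c → x ≤ l * (b * (b * b)) → y ≤ l * (c * (c * c)) → u ≤ l * (b * b) → v ≤ l * (c * c)
             → l * suc (b + c) + ((x + y) + (2 * u + v)) ≤ l * (suc (b + c) * (suc (b + c) * suc (b + c)))
cube-growth₄ {x = x} {y = y} {u = u} {v = v} l b c hx hy hu hv = begin
  l * suc (b + c) + ((x + y) + (2 * u + v))
    ≤⟨ +-monoʳ-≤ (l * suc (b + c)) (+-mono-≤ (+-mono-≤ hx hy) (+-mono-≤ (*-monoʳ-≤ 2 hu) hv)) ⟩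
  l * suc (b + c) + ((l * (b * (b * b)) + l * (c * (c * c))) + (2 * (l * (b * b)) + l * (c * c)))
    ≤⟨ ≤-by-slack (l * (3 * b * b * c + 3 * b * c * c + b * b + 2 * c * c + 6 * b * c + 2 * b + 2 * c))
                  (solve (l ∷ b ∷ c ∷ [])) ⟩
  l * (suc (b + c) * (suc (b + c) * suc (b + c)))
    ∎
  where open ≤-Reasoning

cube-growth₅ : ∀ l b c → x ≤ l * (b * (b * b)) → y ≤ l * (c * (c * c)) → u ≤ l * (b * b) → v ≤ l * (c * c)
             → z ≤ l * (suc (suc (b + c) + suc (b + c)) * suc (suc (b + c) + suc (b + c)))
             → l * suc (b + c) + ((x + y) + (2 * u + v) + 2 * z)
               ≤ 20 * l * (suc (b + c) * (suc (b + c) * suc (b + c)))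
cube-growth₅ {x = x} {y = y} {u = u} {v = v} {z = z} l b c hx hy hu hv hz = begin
  l * suc (b + c) + ((x + y) + (2 * u + v) + 2 * z)
    ≤⟨ +-monoʳ-≤ (l * suc (b + c))
                 (+-mono-≤ (+-mono-≤ (+-mono-≤ hx hy) (+-mono-≤ (*-monoʳ-≤ 2 hu) hv)) (*-monoʳ-≤ 2 hz)) ⟩
  l * suc (b + c) + ((l * (b * (b * b)) + l * (c * (c * c))) + (2 * (l * (b * b)) + l * (c * c))
                     + 2 * (l * (suc (suc (b + c) + suc (b + c)) * suc (suc (b + c) + suc (b + c)))))
    ≤⟨ ≤-by-slack (l * (19 * b * b * b + 19 * c * c * c + 60 * b * b * c + 60 * b * c * c
                        + 50 * b * b + 51 * c * c + 104 * b * c + 35 * b + 35 * c + 1))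
                  (solve (l ∷ b ∷ c ∷ [])) ⟩
  20 * l * (suc (b + c) * (suc (b + c) * suc (b + c)))
    ∎
  where open ≤-Reasoning

∣∣-positive : ∀ A → 1 ≤ ∣ A ∣
∣∣-positive (atom _) = s≤s z≤n
∣∣-positive 𝟘        = s≤s z≤n
∣∣-positive 𝟙        = s≤s z≤n
∣∣-positive (_ ∧ _)  = s≤s z≤n
∣∣-positive (_ ∨ _)  = s≤s z≤n
∣∣-positive (_ ⊛ _)  = s≤s z≤n
∣∣-positive (_ ⇒ _)  = s≤s z≤n

square≤cube : ∀ l → 1 ≤ n → l * (n * n) ≤ 20 * l * (n * (n * n))
square≤cube {n = suc m} l _ =
  ≤-by-slack (l * (20 * m * m * m + 59 * m * m + 58 * m + 19)) (solve (l ∷ m ∷ []))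

cube-absorbs-linear : ∀ l → 1 ≤ n → x ≤ l * (n * (n * n)) → l * suc n + x ≤ 20 * l * (n * (n * n))
cube-absorbs-linear {n = suc m} {x} l _ hx = begin
  l * suc (suc m) + x                             ≤⟨ +-monoʳ-≤ (l * suc (suc m)) hx ⟩
  l * suc (suc m) + l * (suc m * (suc m * suc m)) ≤⟨ ≤-by-slack (l * (19 * m * m * m + 57 * m * m + 56 * m + 17))
                                                                (solve (l ∷ m ∷ [])) ⟩
  20 * l * (suc m * (suc m * suc m))              ∎
  where open ≤-Reasoning

-- L is a parameter rather than a literal because unification would otherwise unfold L * n.
-- Every local cost α + β ∣ B ∣ + γ ∣ C ∣ below has α, β, γ ≤ 264 (the maximum is decide-∨'s α).
module Bounds (L : ℕ) (264≤L : 264 ≤ L) where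

  coefficient : ∀ α {_ : T (α ≤ᵇ 264)} → α ≤ L
  coefficient α {α≤264} = ≤-trans (≤ᵇ⇒≤ α 264 α≤264) 264≤L

  local-cost : ∀ α β γ b c {X e} {_ : T (α ≤ᵇ 264)} {_ : T (β ≤ᵇ 264)} {_ : T (γ ≤ᵇ 264)}
             → e ≡ α + β * b + γ * c + X → e ≤ L * suc (b + c) + X
  local-cost α β γ b c {X} {e} {α≤} {β≤} {γ≤} cost = begin
    e                     ≡⟨ cost ⟩
    α + β * b + γ * c + X ≤⟨ +-monoˡ-≤ X (+-mono-≤ (+-mono-≤ (coefficient α {α≤})
                                                             (*-monoˡ-≤ b (coefficient β {β≤})))
                                                   (*-monoˡ-≤ c (coefficient γ {γ≤}))) ⟩
    L + L * b + L * c + X ≡⟨ solve (L ∷ b ∷ c ∷ X ∷ []) ⟩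
    L * suc (b + c) + X   ∎
    where open ≤-Reasoning

  local-cost₁ : ∀ α β n {X e} {_ : T (α ≤ᵇ 264)} {_ : T (β ≤ᵇ 264)}
              → e ≡ α + β * n + X → e ≤ L * suc n + X
  local-cost₁ α β n {X} {e} {α≤} {β≤} cost = begin
    e             ≡⟨ cost ⟩
    α + β * n + X ≤⟨ +-monoˡ-≤ X (+-mono-≤ (coefficient α {α≤}) (*-monoˡ-≤ n (coefficient β {β≤}))) ⟩
    L + L * n + X ≡⟨ solve (L ∷ n ∷ X ∷ []) ⟩
    L * suc n + X ∎
    where open ≤-Reasoning

  constant≤ : ∀ α {_ : T (α ≤ᵇ 264)} k .{{_ : NonZero k}} → α ≤ L * k
  constant≤ α {α≤} k = ≤-trans (coefficient α {α≤}) (m≤m*n L k)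

  ‖discard-∧‖ : (uB : Proof [ B ] (just 𝟙)) → ‖ discard-∧ {C = C} uB ‖ ≤ L * ∣ B ∧ C ∣ + ‖ uB ‖
  ‖discard-∧‖ {B} {C} uB = local-cost 3 1 1 ∣ B ∣ ∣ C ∣ exact
    where
    exact : ‖ discard-∧ {C = C} uB ‖ ≡ 3 + 1 * ∣ B ∣ + 1 * ∣ C ∣ + ‖ uB ‖
    exact with ∣ B ∣ | ∣ C ∣ | ‖ uB ‖
    ... | b | c | x = solve (b ∷ c ∷ x ∷ [])

  ‖discard-∨‖ : (uB : Proof [ B ] (just 𝟙)) (uC : Proof [ C ] (just 𝟙))
              → ‖ discard-∨ uB uC ‖ ≤ L * ∣ B ∨ C ∣ + (‖ uB ‖ + ‖ uC ‖)
  ‖discard-∨‖ {B} {C} uB uC = local-cost 3 1 1 ∣ B ∣ ∣ C ∣ exact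
    where
    exact : ‖ discard-∨ uB uC ‖ ≡ 3 + 1 * ∣ B ∣ + 1 * ∣ C ∣ + (‖ uB ‖ + ‖ uC ‖)
    exact with ∣ B ∣ | ∣ C ∣ | ‖ uB ‖ | ‖ uC ‖
    ... | b | c | x | y = solve (b ∷ c ∷ x ∷ y ∷ [])

  ‖discard-⊛‖ : (uB : Proof [ B ] (just 𝟙)) (uC : Proof [ C ] (just 𝟙))
              → ‖ discard-⊛ uB uC ‖ ≤ L * ∣ B ⊛ C ∣ + (‖ uB ‖ + ‖ uC ‖)
  ‖discard-⊛‖ {B} {C} uB uC = local-cost 8 2 3 ∣ B ∣ ∣ C ∣ exact
    where
    exact : ‖ discard-⊛ uB uC ‖ ≡ 8 + 2 * ∣ B ∣ + 3 * ∣ C ∣ + (‖ uB ‖ + ‖ uC ‖)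
    exact with ∣ B ∣ | ∣ C ∣ | ‖ uB ‖ | ‖ uC ‖
    ... | b | c | x | y = solve (b ∷ c ∷ x ∷ y ∷ [])

  ‖explode-∧‖ : (zB : Proof [ 𝟘 ] (just B)) (zC : Proof [ 𝟘 ] (just C))
              → ‖ explode-∧ zB zC ‖ ≤ L * ∣ B ∧ C ∣ + (‖ zB ‖ + ‖ zC ‖)
  ‖explode-∧‖ {B} {C} zB zC = local-cost 3 1 1 ∣ B ∣ ∣ C ∣ exact
    where
    exact : ‖ explode-∧ zB zC ‖ ≡ 3 + 1 * ∣ B ∣ + 1 * ∣ C ∣ + (‖ zB ‖ + ‖ zC ‖)
    exact with ∣ B ∣ | ∣ C ∣ | ‖ zB ‖ | ‖ zC ‖
    ... | b | c | x | y = solve (b ∷ c ∷ x ∷ y ∷ [])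

  ‖explode-∨‖ : (zB : Proof [ 𝟘 ] (just B)) → ‖ explode-∨ {C = C} zB ‖ ≤ L * ∣ B ∨ C ∣ + ‖ zB ‖
  ‖explode-∨‖ {B} {C} zB = local-cost 3 1 1 ∣ B ∣ ∣ C ∣ exact
    where
    exact : ‖ explode-∨ {C = C} zB ‖ ≡ 3 + 1 * ∣ B ∣ + 1 * ∣ C ∣ + ‖ zB ‖
    exact with ∣ B ∣ | ∣ C ∣ | ‖ zB ‖
    ... | b | c | x = solve (b ∷ c ∷ x ∷ [])

  ‖explode-⊛‖ : (zB : Proof [ 𝟘 ] (just B)) (zC : Proof [ 𝟘 ] (just C))
              → ‖ explode-⊛ zB zC ‖ ≤ L * ∣ B ⊛ C ∣ + (‖ zB ‖ + ‖ zC ‖)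
  ‖explode-⊛‖ {B} {C} zB zC = local-cost 17 3 3 ∣ B ∣ ∣ C ∣ exact
    where
    exact : ‖ explode-⊛ zB zC ‖ ≡ 17 + 3 * ∣ B ∣ + 3 * ∣ C ∣ + (‖ zB ‖ + ‖ zC ‖)
    exact with ∣ B ∣ | ∣ C ∣ | ‖ zB ‖ | ‖ zC ‖
    ... | b | c | x | y = solve (b ∷ c ∷ x ∷ y ∷ [])

  ‖decide-∨‖ : (eB : Proof [] (just (B ∨ ∼ B))) (eC : Proof [] (just (C ∨ ∼ C)))
             → ‖ decide-∨ eB eC ‖ ≤ L * ∣ B ∨ C ∣ + (‖ eB ‖ + ‖ eC ‖)
  ‖decide-∨‖ {B} {C} eB eC = local-cost 264 50 47 ∣ B ∣ ∣ C ∣ exact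
    where
    exact : ‖ decide-∨ eB eC ‖ ≡ 264 + 50 * ∣ B ∣ + 47 * ∣ C ∣ + (‖ eB ‖ + ‖ eC ‖)
    exact with ∣ B ∣ | ∣ C ∣ | ‖ eB ‖ | ‖ eC ‖
    ... | b | c | x | y = solve (b ∷ c ∷ x ∷ y ∷ [])

  ‖decide-∧‖ : (eB : Proof [] (just (B ∨ ∼ B))) (eC : Proof [] (just (C ∨ ∼ C)))
               (uB : Proof [ B ] (just 𝟙)) (uC : Proof [ C ] (just 𝟙))
             → ‖ decide-∧ eB eC uB uC ‖
               ≤ L * ∣ B ∧ C ∣ + ((‖ eB ‖ + ‖ eC ‖) + (2 * ‖ uB ‖ + ‖ uC ‖))
  ‖decide-∧‖ {B} {C} eB eC uB uC = local-cost 201 49 47 ∣ B ∣ ∣ C ∣ exact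
    where
    exact : ‖ decide-∧ eB eC uB uC ‖
            ≡ 201 + 49 * ∣ B ∣ + 47 * ∣ C ∣ + ((‖ eB ‖ + ‖ eC ‖) + (2 * ‖ uB ‖ + ‖ uC ‖))
    exact with ∣ B ∣ | ∣ C ∣ | ‖ eB ‖ | ‖ eC ‖ | ‖ uB ‖ | ‖ uC ‖
    ... | b | c | x | y | u | v = solve (b ∷ c ∷ x ∷ y ∷ u ∷ v ∷ [])

  ‖decide-⊛‖ : (eB : Proof [] (just (B ∨ ∼ B))) (eC : Proof [] (just (C ∨ ∼ C)))
               (uB : Proof [ B ] (just 𝟙)) (uC : Proof [ C ] (just 𝟙))
             → ‖ decide-⊛ eB eC uB uC ‖
               ≤ L * ∣ B ⊛ C ∣ + ((‖ eB ‖ + ‖ eC ‖) + (2 * ‖ uB ‖ + ‖ uC ‖))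
  ‖decide-⊛‖ {B} {C} eB eC uB uC = local-cost 221 49 47 ∣ B ∣ ∣ C ∣ exact
    where
    exact : ‖ decide-⊛ eB eC uB uC ‖
            ≡ 221 + 49 * ∣ B ∣ + 47 * ∣ C ∣ + ((‖ eB ‖ + ‖ eC ‖) + (2 * ‖ uB ‖ + ‖ uC ‖))
    exact with ∣ B ∣ | ∣ C ∣ | ‖ eB ‖ | ‖ eC ‖ | ‖ uB ‖ | ‖ uC ‖
    ... | b | c | x | y | u | v = solve (b ∷ c ∷ x ∷ y ∷ u ∷ v ∷ [])

  ‖duplicate-∨‖ : (dB : Proof [ B ] (just (B ⊛ B))) (dC : Proof [ C ] (just (C ⊛ C)))
                → ‖ duplicate-∨ dB dC ‖ ≤ L * ∣ B ∨ C ∣ + (‖ dB ‖ + ‖ dC ‖)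
  ‖duplicate-∨‖ {B} {C} dB dC = local-cost 43 30 30 ∣ B ∣ ∣ C ∣ exact
    where
    exact : ‖ duplicate-∨ dB dC ‖ ≡ 43 + 30 * ∣ B ∣ + 30 * ∣ C ∣ + (‖ dB ‖ + ‖ dC ‖)
    exact with ∣ B ∣ | ∣ C ∣ | ‖ dB ‖ | ‖ dC ‖
    ... | b | c | x | y = solve (b ∷ c ∷ x ∷ y ∷ [])

  ‖duplicate-⊛‖ : (dB : Proof [ B ] (just (B ⊛ B))) (dC : Proof [ C ] (just (C ⊛ C)))
                → ‖ duplicate-⊛ dB dC ‖ ≤ L * ∣ B ⊛ C ∣ + (‖ dB ‖ + ‖ dC ‖)
  ‖duplicate-⊛‖ {B} {C} dB dC = local-cost 37 30 29 ∣ B ∣ ∣ C ∣ exact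
    where
    exact : ‖ duplicate-⊛ dB dC ‖ ≡ 37 + 30 * ∣ B ∣ + 29 * ∣ C ∣ + (‖ dB ‖ + ‖ dC ‖)
    exact with ∣ B ∣ | ∣ C ∣ | ‖ dB ‖ | ‖ dC ‖
    ... | b | c | x | y = solve (b ∷ c ∷ x ∷ y ∷ [])

  ‖duplicate-∧‖ : (eB : Proof [] (just (B ∨ ∼ B))) (eC : Proof [] (just (C ∨ ∼ C)))
                  (uB : Proof [ B ] (just 𝟙)) (uC : Proof [ C ] (just 𝟙))
                  (z : Proof [ 𝟘 ] (just ((B ∧ C) ⊛ (B ∧ C))))
                → ‖ duplicate-∧ eB eC uB uC z ‖
                  ≤ L * ∣ B ∧ C ∣ + ((‖ eB ‖ + ‖ eC ‖) + (2 * ‖ uB ‖ + ‖ uC ‖) + 2 * ‖ z ‖)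
  ‖duplicate-∧‖ {B} {C} eB eC uB uC z = local-cost 123 53 52 ∣ B ∣ ∣ C ∣ exact
    where
    exact : ‖ duplicate-∧ eB eC uB uC z ‖
            ≡ 123 + 53 * ∣ B ∣ + 52 * ∣ C ∣
              + ((‖ eB ‖ + ‖ eC ‖) + (2 * ‖ uB ‖ + ‖ uC ‖) + 2 * ‖ z ‖)
    exact with ∣ B ∣ | ∣ C ∣ | ‖ eB ‖ | ‖ eC ‖ | ‖ uB ‖ | ‖ uC ‖ | ‖ z ‖
    ... | b | c | x | y | u | v | w = solve (b ∷ c ∷ x ∷ y ∷ u ∷ v ∷ w ∷ [])

  ‖excluded-middle‖ : (e : Proof [] (just (A ∨ ∼ A))) → ‖ excluded-middle e ‖ ≤ L * suc ∣ A ∣ + ‖ e ‖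
  ‖excluded-middle‖ {A} e = local-cost₁ 38 18 ∣ A ∣ exact
    where
    exact : ‖ excluded-middle e ‖ ≡ 38 + 18 * ∣ A ∣ + ‖ e ‖
    exact with ∣ A ∣ | ‖ e ‖
    ... | n | x = solve (n ∷ x ∷ [])

  discard-bound : (s : StarNNF A) → ‖ discard s ‖ ≤ L * (∣ A ∣ * ∣ A ∣)
  discard-bound (pos p)            = constant≤ 3 1
  discard-bound (neg p)            = constant≤ 5 9
  discard-bound (conj {B} {C} s _) = ≤-trans (‖discard-∧‖ {C = C} (discard s))
                                             (square-growth₁ L ∣ B ∣ ∣ C ∣ (discard-bound s))
  discard-bound (disj {B} {C} s t) = ≤-trans (‖discard-∨‖ (discard s) (discard t))
                                             (square-growth₂ L ∣ B ∣ ∣ C ∣ (discard-bound s) (discard-bound t))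
  discard-bound (fus {B} {C} s t)  = ≤-trans (‖discard-⊛‖ (discard s) (discard t))
                                             (square-growth₂ L ∣ B ∣ ∣ C ∣ (discard-bound s) (discard-bound t))

  explode-bound : (s : StarNNF A) → ‖ explode s ‖ ≤ L * (∣ A ∣ * ∣ A ∣)
  explode-bound (pos p)            = constant≤ 3 1
  explode-bound (neg p)            = constant≤ 5 9
  explode-bound (conj {B} {C} s t) = ≤-trans (‖explode-∧‖ (explode s) (explode t))
                                             (square-growth₂ L ∣ B ∣ ∣ C ∣ (explode-bound s) (explode-bound t))
  explode-bound (disj {B} {C} s _) = ≤-trans (‖explode-∨‖ {C = C} (explode s))
                                             (square-growth₁ L ∣ B ∣ ∣ C ∣ (explode-bound s))
  explode-bound (fus {B} {C} s t)  = ≤-trans (‖explode-⊛‖ (explode s) (explode t))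
                                             (square-growth₂ L ∣ B ∣ ∣ C ∣ (explode-bound s) (explode-bound t))

  decide-bound : (s : StarNNF A) → ‖ decide s ‖ ≤ L * (∣ A ∣ * (∣ A ∣ * ∣ A ∣))
  decide-bound (pos p)            = constant≤ 71 1
  decide-bound (neg p)            = constant≤ 101 27
  decide-bound (conj {B} {C} s t) =
    ≤-trans (‖decide-∧‖ (decide s) (decide t) (discard s) (discard t))
            (cube-growth₄ L ∣ B ∣ ∣ C ∣ (decide-bound s) (decide-bound t) (discard-bound s) (discard-bound t))
  decide-bound (disj {B} {C} s t) =
    ≤-trans (‖decide-∨‖ (decide s) (decide t))
            (cube-growth₂ L ∣ B ∣ ∣ C ∣ ≤-refl (decide-bound s) (decide-bound t))
  decide-bound (fus {B} {C} s t)  =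
    ≤-trans (‖decide-⊛‖ (decide s) (decide t) (discard s) (discard t))
            (cube-growth₄ L ∣ B ∣ ∣ C ∣ (decide-bound s) (decide-bound t) (discard-bound s) (discard-bound t))

  duplicate-bound : (s : StarNNF A) → ‖ duplicate s ‖ ≤ 20 * L * (∣ A ∣ * (∣ A ∣ * ∣ A ∣))
  duplicate-bound (pos p)            = ≤-trans (constant≤ 82 1) (*-monoˡ-≤ 1 (m≤n*m L 20))
  duplicate-bound (neg p)            = ≤-trans (constant≤ 130 27) (*-monoˡ-≤ 27 (m≤n*m L 20))
  duplicate-bound (conj {B} {C} s t) =
    ≤-trans (‖duplicate-∧‖ (decide s) (decide t) (discard s) (discard t) (explode A⊛A))
            (cube-growth₅ L ∣ B ∣ ∣ C ∣ (decide-bound s) (decide-bound t) (discard-bound s) (discard-bound t)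
                          (explode-bound A⊛A))
    where
    A⊛A : StarNNF ((B ∧ C) ⊛ (B ∧ C))
    A⊛A = fus (conj s t) (conj s t)
  duplicate-bound (disj {B} {C} s t) =
    ≤-trans (‖duplicate-∨‖ (duplicate s) (duplicate t))
            (cube-growth₂ (20 * L) ∣ B ∣ ∣ C ∣ (m≤n*m L 20) (duplicate-bound s) (duplicate-bound t))
  duplicate-bound (fus {B} {C} s t)  =
    ≤-trans (‖duplicate-⊛‖ (duplicate s) (duplicate t))
            (cube-growth₂ (20 * L) ∣ B ∣ ∣ C ∣ (m≤n*m L 20) (duplicate-bound s) (duplicate-bound t))

  within-cube : ∀ n (π : Proof Γ Δ) → ‖ π ‖ ≤ 20 * L * (n * (n * n)) → ProvableWithin Γ Δ (20 * L * n ^ 3)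
  within-cube n π h = π , subst (_≤ _) (‖‖≡size π) (≤-trans h (≤-reflexive n*[n*n]≡n^3))
    where
    n*[n*n]≡n^3 : 20 * L * (n * (n * n)) ≡ 20 * L * n ^ 3
    n*[n*n]≡n^3 = cong (λ m → 20 * L * (n * (n * m))) (sym (*-identityʳ n))

  discard-within : StarNNF A → ProvableWithin [ A ] (just 𝟙) (20 * L * ∣ A ∣ ^ 3)
  discard-within {A} s =
    within-cube ∣ A ∣ (discard s) (≤-trans (discard-bound s) (square≤cube L (∣∣-positive A)))

  explode-within : StarNNF A → ProvableWithin [ 𝟘 ] (just A) (20 * L * ∣ A ∣ ^ 3)
  explode-within {A} s =
    within-cube ∣ A ∣ (explode s) (≤-trans (explode-bound s) (square≤cube L (∣∣-positive A)))

  excluded-middle-within : StarNNF A → ProvableWithin [] (just (A ∨ ¬ A)) (20 * L * ∣ A ∣ ^ 3)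
  excluded-middle-within {A} s =
    within-cube ∣ A ∣ (excluded-middle (decide s))
                (≤-trans (‖excluded-middle‖ (decide s)) (cube-absorbs-linear L (∣∣-positive A) (decide-bound s)))

  duplicate-within : StarNNF A → ProvableWithin [ A ] (just (A ⊛ A)) (20 * L * ∣ A ∣ ^ 3)
  duplicate-within {A} s = within-cube ∣ A ∣ (duplicate s) (duplicate-bound s)

lemma34 : ∃[ c ] ∃[ k ] (∀ A → StarNNF A →
              ProvableWithin [ A ] (just 𝟙) (c * ∣ A ∣ ^ k)
              × ProvableWithin [ 𝟘 ] (just A) (c * ∣ A ∣ ^ k)
              × ProvableWithin [] (just (A ∨ ¬ A)) (c * ∣ A ∣ ^ k)
              × ProvableWithin [ A ] (just (A ⊛ A)) (c * ∣ A ∣ ^ k))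
lemma34 = 20 * 264 , 3 , λ A s → discard-within s , explode-within s , excluded-middle-within s , duplicate-within s
  where open Bounds 264 ≤-refl
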